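{- The dynamic $s$-$t$-reachability query is not in $\mathrm{DynPropCQ}$, i.e., it cannot be maintained by a dynamic program all of whose update formulas are conjunctions of atomic formulas (no negation, no disjunction, no quantifiers).
   Context: An $s$-$t$-graph is a structure over the schema with one binary relation symbol $E$ and two constants $s,t$; the $s$-$t$-reachability query is true iff there is a directed path from $s$ to $t$. Dynamic setting: input and auxiliary schemas are relational, no built-in data, no auxiliary functions. Concrete modifications insert or delete a single tuple of an input relation (constants never modified). An update program has, for every auxiliary relation symbol $R$ and every abstract modification $\delta\in\{\mathrm{ins}_S,\mathrm{del}_S\}$, $S$ an input relation symbol, a formula $\varphi^R_\delta(\vec x;\vec y)$ over the input and auxiliary schema; after $\delta(\vec a)$, the input is modified and $R$ becomes $\{\vec b:\text{old state}\models\varphi^R_\delta(\vec a;\vec b)\}$. A dynamic program has an arbitrary initialization mapping from input databases to auxiliary databases over the same domain and a query symbol $Q$; it maintains a query if for every input database $\mathcal D$ and every finite modification sequence $\alpha$, $Q$ after applying $\alpha$ to the initial state equals the query answer on $\alpha(\mathcal D)$. $\mathrm{DynPropCQ}$ is the class of queries maintainable by such programs whose update formulas are conjunctive (conjunctions of literals) and negation-free, i.e., conjunctions of atomic formulas. -}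

module Defs where

open import Data.Nat using (ℕ)
open import Data.Fin using (Fin; zero; suc; _≟_)
open import Data.Bool using (Bool; true; false; _∧_; if_then_else_)
open import Data.Vec using (Vec; []; lookup; map)
open import Data.List using (List; []; _∷_)
open import Data.Sum using (_⊎_; inj₁; inj₂)
open import Data.Product using (Σ; _×_)
open import Function.Bundles using (_⇔_)
open import Relation.Nullary.Decidable using (⌊_⌋)
open import Relation.Binary.PropositionalEquality using (_≡_; subst; sym)
open import Relation.Binary.Construct.Closure.ReflexiveTransitive using (Star)

record InputDB (n : ℕ) : Set where
  constructor graph
  field
    E : Fin n → Fin n → Bool
    s : Fin n
    t : Fin n

Reach : ∀ {n} → InputDB n → Set
Reach {n} D = Star (λ (a b : Fin n) → InputDB.E D a b ≡ true) (InputDB.s D) (InputDB.t D)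

-- Modifications.  The only input relation symbol is E (binary);
-- the constants s, t are never modified.

data AbsMod : Set where
  ins del : AbsMod

record Mod (n : ℕ) : Set where
  constructor mod
  field
    δ : AbsMod
    a : Fin n
    b : Fin n

insVal : AbsMod → Bool
insVal ins = true
insVal del = false

applyInput : ∀ {n} → Mod n → InputDB n → InputDB n
applyInput (mod δ a b) (graph E s t) = graph E' s t
  where
  val : Bool
  val = insVal δ
  E' : _ → _ → Bool
  E' x y = if ⌊ x ≟ a ⌋ ∧ ⌊ y ≟ b ⌋ then val else E x y

applyInputSeq : ∀ {n} → List (Mod n) → InputDB n → InputDB n
applyInputSeq []       D = D
applyInputSeq (α ∷ αs) D = applyInputSeq αs (applyInput α D)

AuxDB : (m : ℕ) → (Fin m → ℕ) → ℕ → Set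
AuxDB m ar n = (i : Fin m) → Vec (Fin n) (ar i) → Bool

data Term (V : Set) : Set where
  var : V → Term V
  cs  : Term V
  ct  : Term V

data Atom (m : ℕ) (ar : Fin m → ℕ) (V : Set) : Set where
  E-atom  : Term V → Term V → Atom m ar V
  R-atom  : (i : Fin m) → Vec (Term V) (ar i) → Atom m ar V
  eq-atom : Term V → Term V → Atom m ar V

CQ : (m : ℕ) → (Fin m → ℕ) → Set → Set
CQ m ar V = List (Atom m ar V)

record State (m : ℕ) (ar : Fin m → ℕ) (n : ℕ) : Set where
  constructor state
  field
    input : InputDB n
    aux   : AuxDB m ar n

module _ {m : ℕ} {ar : Fin m → ℕ} {n : ℕ} (S : State m ar n) where
  open State S
  open InputDB input

  evalTerm : {V : Set} → (V → Fin n) → Term V → Fin n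
  evalTerm ρ (var x) = ρ x
  evalTerm ρ cs      = s
  evalTerm ρ ct      = t

  evalAtom : {V : Set} → (V → Fin n) → Atom m ar V → Bool
  evalAtom ρ (E-atom u w)  = E (evalTerm ρ u) (evalTerm ρ w)
  evalAtom ρ (R-atom i us) = aux i (map (evalTerm ρ) us)
  evalAtom ρ (eq-atom u w) = ⌊ evalTerm ρ u ≟ evalTerm ρ w ⌋

  evalCQ : {V : Set} → (V → Fin n) → CQ m ar V → Bool
  evalCQ ρ []       = true
  evalCQ ρ (α ∷ φ) = evalAtom ρ α ∧ evalCQ ρ φ

-- DynPropCQ programs for s-t-reachability.
-- φ δ i is the update formula φ^{R_i}_δ(x₁,x₂ ; y₁..y_{ar i}):
-- variables inj₁ j are the modification parameters x, inj₂ j the y's.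

record DynPropCQProgram : Set₁ where
  field
    m     : ℕ
    ar    : Fin m → ℕ
    φ     : AbsMod → (i : Fin m) → CQ m ar (Fin 2 ⊎ Fin (ar i))
    init  : ∀ {n} → InputDB n → AuxDB m ar n
    Q     : Fin m
    Q-0ary : ar Q ≡ 0

  -- One update step: aux relations are recomputed from the OLD state,
  -- then the input is modified.
  step : ∀ {n} → Mod n → State m ar n → State m ar n
  step {n} (mod δ a b) S = state (applyInput (mod δ a b) (State.input S)) aux'
    where
    ρ : (i : Fin m) → Vec (Fin n) (ar i) → Fin 2 ⊎ Fin (ar i) → Fin n
    ρ i ys (inj₁ zero)       = a
    ρ i ys (inj₁ (suc zero)) = b
    ρ i ys (inj₂ j)          = lookup ys j
    aux' : AuxDB m ar n
    aux' i ys = evalCQ S (ρ i ys) (φ δ i)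

  run : ∀ {n} → List (Mod n) → State m ar n → State m ar n
  run []       S = S
  run (α ∷ αs) S = run αs (step α S)

  initState : ∀ {n} → InputDB n → State m ar n
  initState D = state D (init D)

  Qval : ∀ {n} → State m ar n → Bool
  Qval {n} S = State.aux S Q (subst (Vec (Fin n)) (sym Q-0ary) [])

Maintains : DynPropCQProgram → Set
Maintains P = ∀ (n : ℕ) (D : InputDB n) (α : List (Mod n)) →
  (Qval (run α (initState D)) ≡ true) ⇔ Reach (applyInputSeq α D)
  where open DynPropCQProgram P

-- Let K bound the arities of the auxiliary relations (and 2).  Over the domain {s, t, w, x₀, …, x_K}
-- start from the single edge w → t and insert the path s → x₀ → … → x_K: t stays unreachable.
-- Let π_j swap x_j and w; running the π_j-image of the insertions reroutes the path through w, so
-- there t becomes reachable.  Negation-free conjunctive updates preserve the invariant "a fact about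
-- a w-free tuple ȳ holds in the original run as soon as π_j ȳ holds in every transformed run j":
-- each atom transfers along the family (an equality atom already along one injective π_j).
-- Initially all runs share one state, and a w-free tuple of length ≤ K misses some x_j, hence is
-- fixed by π_j.  So the 0-ary query holds in the original run, although t is unreachable there.

module Submission where

open import Defs
open import Relation.Nullary using (¬_)
open import Data.Nat using (ℕ; _+_; _≤_; _<_; s≤s)
open import Data.Nat.Properties using (≤-refl; ≤-<-trans; <-irrefl)
open import Data.Fin using (Fin; zero; suc; _≟_)
open import Data.Fin.Properties using (¬∀⟶∃¬; injective⇒≤; suc-injective)
open import Data.Fin.Permutation.Components using (transpose; transpose-inverse)
open import Data.Bool using (true; _∧_)
open import Data.Bool.Properties using (T-≡; ∧-conicalˡ; ∧-conicalʳ)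
open import Data.Vec using (Vec; []; _∷_)
import Data.Vec as Vec
open import Data.Vec.Properties using (map-cong; map-∘; lookup-map; ∷-injectiveˡ; ∷-injectiveʳ)
open import Data.Vec.Relation.Unary.All as All using (All; []; _∷_)
open import Data.Vec.Relation.Unary.All.Properties using (map⁺; lookup⁺)
open import Data.Vec.Relation.Unary.Any using (here; there; index; any?)
open import Data.Vec.Relation.Unary.Any.Properties using (lookup-index)
open import Data.Vec.Membership.Propositional using (_∈_; _∉_)
open import Data.List using (List; []; _∷_; tabulate)
import Data.List as List
import Data.List.Relation.Unary.All as ListAll
import Data.List.Relation.Unary.Any as ListAny
import Data.List.Membership.Propositional as ListMembership
open import Data.List.Membership.Propositional.Properties using (∈-tabulate⁺; ∈-tabulate⁻; ∈-map⁺)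
open import Data.List.Relation.Unary.All.Properties using (tabulate⁺; tabulate⁻)
open import Data.List.Extrema.Nat using (max; xs≤max; v≤max⁺)
open import Data.Sum using (_⊎_; inj₁; inj₂)
open import Data.Product using (_×_; _,_; ∃; proj₂)
open import Function using (_∘_; id; case_of_)
open import Function.Bundles using (Equivalence)
open import Function.Definitions using (Injective)
open import Relation.Nullary using (yes; no; _×-dec_; contradiction)
open import Relation.Nullary.Decidable using (⌊_⌋; toWitness; fromWitness; dec-true; dec-false)
open import Relation.Binary.PropositionalEquality
open import Relation.Binary.Construct.Closure.ReflexiveTransitive using (Star; ε; _◅_; _◅◅_; fold)

⌊≟⌋⇒≡ : ∀ {n} {x y : Fin n} → ⌊ x ≟ y ⌋ ≡ true → x ≡ y
⌊≟⌋⇒≡ = toWitness ∘ Equivalence.from T-≡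

≡⇒⌊≟⌋ : ∀ {n} {x y : Fin n} → x ≡ y → ⌊ x ≟ y ⌋ ≡ true
≡⇒⌊≟⌋ = Equivalence.to T-≡ ∘ fromWitness

module _ {n : ℕ} where

  transpose-injective : (i j : Fin n) → Injective _≡_ _≡_ (transpose i j)
  transpose-injective i j {u} {v} eq = begin
    u                              ≡⟨ transpose-inverse j i ⟨
    transpose j i (transpose i j u) ≡⟨ cong (transpose j i) eq ⟩
    transpose j i (transpose i j v) ≡⟨ transpose-inverse j i ⟩
    v                              ∎
    where open ≡-Reasoning

  transpose-sends : (i j : Fin n) → transpose i j i ≡ j
  transpose-sends i j rewrite dec-true (i ≟ i) refl = refl

  transpose-fixes : ∀ {i j k : Fin n} → k ≢ i → k ≢ j → transpose i j k ≡ k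
  transpose-fixes {i} {j} {k} k≢i k≢j
    rewrite dec-false (k ≟ i) k≢i | dec-false (k ≟ j) k≢j = refl

  map-transpose-fixes : ∀ {L} {i j : Fin n} (ys : Vec (Fin n) L) →
                        i ∉ ys → All (_≢ j) ys → Vec.map (transpose i j) ys ≡ ys
  map-transpose-fixes []       _   []           = refl
  map-transpose-fixes (y ∷ ys) i∉ys (y≢j ∷ ys≢j) =
    cong₂ _∷_ (transpose-fixes (i∉ys ∘ here ∘ sym) y≢j)
              (map-transpose-fixes ys (i∉ys ∘ there) ys≢j)

∃-∉ : ∀ {m n L} {x : Fin m → Fin n} → Injective _≡_ _≡_ x →
      (ys : Vec (Fin n) L) → L < m → ∃ λ j → x j ∉ ys
∃-∉ {m} {x = x} x-injective ys L<m =
  ¬∀⟶∃¬ m (λ j → x j ∈ ys) (λ j → any? (x j ≟_) ys) all∈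
  where
  all∈ : ¬ (∀ j → x j ∈ ys)
  all∈ x∈ys = <-irrefl refl (≤-<-trans (injective⇒≤ position-injective) L<m)
    where
    position-injective : Injective _≡_ _≡_ (λ j → index (x∈ys j))
    position-injective {i} {j} eq = x-injective (begin
      x i                              ≡⟨ lookup-index (x∈ys i) ⟩
      Vec.lookup ys (index (x∈ys i))   ≡⟨ cong (Vec.lookup ys) eq ⟩
      Vec.lookup ys (index (x∈ys j))   ≡⟨ lookup-index (x∈ys j) ⟨
      x j                              ∎)
      where open ≡-Reasoning

module _ {A : Set} {P : A → Set} where

  All-length-zero : ∀ {L} → L ≡ 0 → (xs : Vec A L) → All P xs
  All-length-zero refl [] = []

map-length-zero : ∀ {A : Set} {L} → L ≡ 0 → (f : A → A) (xs : Vec A L) → Vec.map f xs ≡ xs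
map-length-zero refl f [] = refl

Edge : ∀ {n} → InputDB n → Fin n → Fin n → Set
Edge D u v = InputDB.E D u v ≡ true

mapMod : ∀ {n} → (Fin n → Fin n) → Mod n → Mod n
mapMod f (mod δ a b) = mod δ (f a) (f b)

module _ {n : ℕ} (D : InputDB n) where
  open InputDB

  E-modified : ∀ δ (a b : Fin n) → E (applyInput (mod δ a b) D) a b ≡ insVal δ
  E-modified δ a b rewrite ≡⇒⌊≟⌋ (refl {x = a}) | ≡⇒⌊≟⌋ (refl {x = b}) = refl

  E-unmodified : ∀ δ {a b u v : Fin n} → ¬ (u ≡ a × v ≡ b) →
                 E (applyInput (mod δ a b) D) u v ≡ E D u v
  E-unmodified δ {a} {b} {u} {v} ≢ab with u ≟ a | v ≟ b
  ... | yes u≡a | yes v≡b = contradiction (u≡a , v≡b) ≢ab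
  ... | yes _   | no _    = refl
  ... | no _    | _       = refl

  E-insert-mono : ∀ {a b u v : Fin n} → Edge D u v → Edge (applyInput (mod ins a b) D) u v
  E-insert-mono {a} {b} {u} {v} uv with (u ≟ a) ×-dec (v ≟ b)
  ... | yes (refl , refl) = E-modified ins a b
  ... | no ≢ab            = trans (E-unmodified ins ≢ab) uv

  E-insert-new : ∀ {a b u v : Fin n} → Edge (applyInput (mod ins a b) D) u v → Edge D u v ⊎ v ≡ b
  E-insert-new {b = b} {v = v} uv = case v ≟ b of λ where
    (yes v≡b) → inj₂ v≡b
    (no v≢b)  → inj₁ (trans (sym (E-unmodified ins (v≢b ∘ proj₂))) uv)

applyInputSeq-s : ∀ {n} (α : List (Mod n)) D → InputDB.s (applyInputSeq α D) ≡ InputDB.s D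
applyInputSeq-s []                D = refl
applyInputSeq-s (mod δ a b ∷ α) D = applyInputSeq-s α _

applyInputSeq-t : ∀ {n} (α : List (Mod n)) D → InputDB.t (applyInputSeq α D) ≡ InputDB.t D
applyInputSeq-t []                D = refl
applyInputSeq-t (mod δ a b ∷ α) D = applyInputSeq-t α _

insertPath : ∀ {n} → Fin n → List (Fin n) → List (Mod n)
insertPath p []       = []
insertPath p (u ∷ us) = mod ins p u ∷ insertPath u us

module _ {n : ℕ} where
  open ListMembership renaming (_∈_ to _∈ₗ_)

  map-insertPath : ∀ (f : Fin n → Fin n) p us →
                   List.map (mapMod f) (insertPath p us) ≡ insertPath (f p) (List.map f us)
  map-insertPath f p []       = refl
  map-insertPath f p (u ∷ us) = cong (mod ins (f p) (f u) ∷_) (map-insertPath f u us)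

  insertPath-All : ∀ {Pr : Fin n → Set} {p us} → Pr p → ListAll.All Pr us →
                   ListAll.All (λ md → Pr (Mod.a md) × Pr (Mod.b md)) (insertPath p us)
  insertPath-All p-ok ListAll.[]            = ListAll.[]
  insertPath-All p-ok (u-ok ListAll.∷ us-ok) = (p-ok , u-ok) ListAll.∷ insertPath-All u-ok us-ok

  insertPath-mono : ∀ p us D {u v : Fin n} → Edge D u v → Edge (applyInputSeq (insertPath p us) D) u v
  insertPath-mono p []       D uv = uv
  insertPath-mono p (u ∷ us) D uv = insertPath-mono u us _ (E-insert-mono D uv)

  insertPath-reaches : ∀ p us D {v : Fin n} → v ∈ₗ us →
                       Star (Edge (applyInputSeq (insertPath p us) D)) p v
  insertPath-reaches p (u ∷ us) D v∈ =
    insertPath-mono u us _ (E-modified D ins p u) ◅ rest v∈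
    where
    rest : ∀ {v} → v ∈ₗ u ∷ us →
           Star (Edge (applyInputSeq (insertPath u us) (applyInput (mod ins p u) D))) u v
    rest (ListAny.here refl) = ε
    rest (ListAny.there v∈)  = insertPath-reaches u us _ v∈

  insertPath-new : ∀ p us D {u v : Fin n} →
                   Edge (applyInputSeq (insertPath p us) D) u v → Edge D u v ⊎ v ∈ₗ us
  insertPath-new p []       D uv = inj₁ uv
  insertPath-new p (w ∷ us) D uv with insertPath-new w us _ uv
  ... | inj₂ v∈us = inj₂ (ListAny.there v∈us)
  ... | inj₁ uv′ with E-insert-new D uv′
  ...   | inj₁ uv″ = inj₁ uv″
  ...   | inj₂ v≡w = inj₂ (ListAny.here v≡w)

module Reflection (P : DynPropCQProgram) {n : ℕ} {J : Set} (j₀ : J) (π : J → Fin n → Fin n)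
                  (π-injective : ∀ j → Injective _≡_ _≡_ (π j)) (Good : Fin n → Set) where
  open DynPropCQProgram P

  St : Set
  St = State m ar n

  record Reflects (Y : St) (Z : J → St) : Set where
    open State
    open InputDB
    field
      s-good       : Good (s (input Y))
      t-good       : Good (t (input Y))
      s-image      : ∀ j → s (input (Z j)) ≡ π j (s (input Y))
      t-image      : ∀ j → t (input (Z j)) ≡ π j (t (input Y))
      E-reflects   : ∀ {u v} → Good u → Good v →
                     (∀ j → Edge (input (Z j)) (π j u) (π j v)) → Edge (input Y) u v
      aux-reflects : ∀ i {ys : Vec (Fin n) (ar i)} → All Good ys →
                     (∀ j → aux (Z j) i (Vec.map (π j) ys) ≡ true) → aux Y i ys ≡ true
  open Reflects

  module _ {Y : St} {Z : J → St} (R : Reflects Y Z) {V : Set}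
           (ρ : V → Fin n) (ρ-good : ∀ v → Good (ρ v))
           (ρs : J → V → Fin n) (ρs-image : ∀ j v → ρs j v ≡ π j (ρ v)) where

    evalTerm-image : ∀ j u → evalTerm (Z j) (ρs j) u ≡ π j (evalTerm Y ρ u)
    evalTerm-image j (var v) = ρs-image j v
    evalTerm-image j cs      = s-image R j
    evalTerm-image j ct      = t-image R j

    evalTerm-good : ∀ u → Good (evalTerm Y ρ u)
    evalTerm-good (var v) = ρ-good v
    evalTerm-good cs      = s-good R
    evalTerm-good ct      = t-good R

    evalAtom-reflects : ∀ α → (∀ j → evalAtom (Z j) (ρs j) α ≡ true) → evalAtom Y ρ α ≡ true
    evalAtom-reflects (E-atom u v) holds = E-reflects R (evalTerm-good u) (evalTerm-good v) λ j →
      subst₂ (Edge (State.input (Z j))) (evalTerm-image j u) (evalTerm-image j v) (holds j)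
    evalAtom-reflects (R-atom i us) holds =
      aux-reflects R i (map⁺ (All.universal evalTerm-good us)) λ j →
        subst (λ ys → State.aux (Z j) i ys ≡ true)
              (trans (map-cong (evalTerm-image j) us) (map-∘ (π j) (evalTerm Y ρ) us)) (holds j)
    evalAtom-reflects (eq-atom u v) holds = ≡⇒⌊≟⌋ (π-injective j₀ (begin
      π j₀ (evalTerm Y ρ u)      ≡⟨ evalTerm-image j₀ u ⟨
      evalTerm (Z j₀) (ρs j₀) u  ≡⟨ ⌊≟⌋⇒≡ (holds j₀) ⟩
      evalTerm (Z j₀) (ρs j₀) v  ≡⟨ evalTerm-image j₀ v ⟩
      π j₀ (evalTerm Y ρ v)      ∎))
      where open ≡-Reasoning

    evalCQ-reflects : ∀ φ → (∀ j → evalCQ (Z j) (ρs j) φ ≡ true) → evalCQ Y ρ φ ≡ true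
    evalCQ-reflects []      holds = refl
    evalCQ-reflects (α ∷ φ) holds =
      cong₂ _∧_ (evalAtom-reflects α (λ j → ∧-conicalˡ _ _ (holds j)))
                (evalCQ-reflects φ (λ j → ∧-conicalʳ _ _ (holds j)))

  step-reflects : ∀ {Y Z} δ {a b} → Good a → Good b → Reflects Y Z →
                  Reflects (step (mod δ a b) Y) (λ j → step (mod δ (π j a) (π j b)) (Z j))
  step-reflects {Y} {Z} δ {a} {b} a-good b-good R = record
    { s-good = s-good R ; t-good = t-good R ; s-image = s-image R ; t-image = t-image R
    ; E-reflects = E-reflects′ ; aux-reflects = aux-reflects′ }
    where
    open State
    E-reflects′ : ∀ {u v} → Good u → Good v →
                  (∀ j → Edge (applyInput (mod δ (π j a) (π j b)) (input (Z j))) (π j u) (π j v)) →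
                  Edge (applyInput (mod δ a b) (input Y)) u v
    E-reflects′ {u} {v} u-good v-good holds with (u ≟ a) ×-dec (v ≟ b)
    ... | yes (refl , refl) =
      trans (E-modified (input Y) δ u v)
            (trans (sym (E-modified (input (Z j₀)) δ (π j₀ u) (π j₀ v))) (holds j₀))
    ... | no ≢ab = trans (E-unmodified (input Y) δ ≢ab) (E-reflects R u-good v-good λ j →
      trans (sym (E-unmodified (input (Z j)) δ λ (πu≡πa , πv≡πb) →
                   ≢ab (π-injective j πu≡πa , π-injective j πv≡πb)))
            (holds j))
    aux-reflects′ : ∀ i {ys : Vec (Fin n) (ar i)} → All Good ys →
                    (∀ j → aux (step (mod δ (π j a) (π j b)) (Z j)) i (Vec.map (π j) ys) ≡ true) →
                    aux (step (mod δ a b) Y) i ys ≡ true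
    aux-reflects′ i {ys} ys-good = evalCQ-reflects R _
      (λ { (inj₁ zero) → a-good ; (inj₁ (suc zero)) → b-good ; (inj₂ l) → lookup⁺ ys-good l })
      _ (λ { j (inj₁ zero) → refl ; j (inj₁ (suc zero)) → refl
           ; j (inj₂ l) → lookup-map l (π j) ys })
      (φ δ i)

  run-reflects : ∀ {Y Z} (α : List (Mod n)) →
                 ListAll.All (λ md → Good (Mod.a md) × Good (Mod.b md)) α → Reflects Y Z →
                 Reflects (run α Y) (λ j → run (List.map (mapMod (π j)) α) (Z j))
  run-reflects []              _                              R = R
  run-reflects (mod δ a b ∷ α) ((a-good , b-good) ListAll.∷ α-good) R =
    run-reflects α α-good (step-reflects δ a-good b-good R)

  Qval-reflects : ∀ {Y Z} → Reflects Y Z → (∀ j → Qval (Z j) ≡ true) → Qval Y ≡ true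
  Qval-reflects {Y} {Z} R holds = aux-reflects R Q (All-length-zero Q-0ary _) λ j →
    subst (λ ys → State.aux (Z j) Q ys ≡ true) (sym (map-length-zero Q-0ary (π j) _)) (holds j)

  reflects-self : ∀ (S : St) K → 2 ≤ K → (∀ i → ar i ≤ K) →
                  let open InputDB (State.input S) in
                  Good s → Good t → (∀ j → π j s ≡ s) → (∀ j → π j t ≡ t) →
                  (∀ {L} (ys : Vec (Fin n) L) → L ≤ K → All Good ys →
                     ∃ λ j → Vec.map (π j) ys ≡ ys) →
                  Reflects S (λ _ → S)
  reflects-self S K 2≤K ar≤K s-good t-good s-fixed t-fixed fixed-by-some = record
    { s-good = s-good ; t-good = t-good
    ; s-image = sym ∘ s-fixed ; t-image = sym ∘ t-fixed
    ; E-reflects = λ {u} {v} u-good v-good holds →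
        let j , fixes = fixed-by-some (u ∷ v ∷ []) 2≤K (u-good ∷ v-good ∷ [])
        in subst₂ (Edge (State.input S))
                  (∷-injectiveˡ fixes) (∷-injectiveˡ (∷-injectiveʳ fixes)) (holds j)
    ; aux-reflects = λ i {ys} ys-good holds →
        let j , fixes = fixed-by-some ys (ar≤K i) ys-good
        in subst (λ ys′ → State.aux S i ys′ ≡ true) fixes (holds j)
    }

module Counterexample (P : DynPropCQProgram) where
  open DynPropCQProgram P

  K : ℕ
  K = max 2 (tabulate ar)

  n : ℕ
  n = 4 + K

  s₀ t₀ w : Fin n
  s₀ = zero
  t₀ = suc zero
  w  = suc (suc zero)

  x : Fin (1 + K) → Fin n
  x j = suc (suc (suc j))

  x-injective : Injective _≡_ _≡_ x
  x-injective = suc-injective ∘ suc-injective ∘ suc-injective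

  π : Fin (1 + K) → Fin n → Fin n
  π j = transpose (x j) w

  Good : Fin n → Set
  Good v = v ≢ w

  open Reflection P zero π (λ j → transpose-injective (x j) w) Good public

  D₀ : InputDB n
  D₀ = graph (λ u v → ⌊ u ≟ w ⌋ ∧ ⌊ v ≟ t₀ ⌋) s₀ t₀

  α : List (Mod n)
  α = insertPath s₀ (tabulate x)

  α[_] : Fin (1 + K) → List (Mod n)
  α[ j ] = List.map (mapMod (π j)) α

  initial-reflects : Reflects (initState D₀) (λ _ → initState D₀)
  initial-reflects = reflects-self (initState D₀) K
    (v≤max⁺ 2 (tabulate ar) (inj₁ ≤-refl)) (tabulate⁻ (xs≤max 2 (tabulate ar)))
    (λ ()) (λ ()) (λ j → refl) (λ j → refl)
    λ ys L≤K ys-good → let j , xj∉ys = ∃-∉ x-injective ys (s≤s L≤K)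
                       in j , map-transpose-fixes ys xj∉ys ys-good

  final-reflects : Reflects (run α (initState D₀)) (λ j → run α[ j ] (initState D₀))
  final-reflects =
    run-reflects α (insertPath-All {Pr = Good} (λ ()) (tabulate⁺ {f = x} λ j ())) initial-reflects

  -- Moving x j to w reroutes the inserted path through w, and w → t₀ is an edge of D₀.
  reachable : ∀ j → Reach (applyInputSeq α[ j ] D₀)
  reachable j = subst (λ β → Reach (applyInputSeq β D₀)) (sym α[j]≡) path
    where
    us : List (Fin n)
    us = List.map (π j) (tabulate x)
    α[j]≡ : α[ j ] ≡ insertPath s₀ us
    α[j]≡ = map-insertPath (π j) s₀ (tabulate x)
    w∈us : w ListMembership.∈ us
    w∈us = subst (ListMembership._∈ us) (transpose-sends (x j) w)
                 (∈-map⁺ (π j) (∈-tabulate⁺ {f = x} j))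
    F : InputDB n
    F = applyInputSeq (insertPath s₀ us) D₀
    path : Reach F
    path = subst₂ (Star (Edge F))
      (sym (applyInputSeq-s (insertPath s₀ us) D₀)) (sym (applyInputSeq-t (insertPath s₀ us) D₀))
      (insertPath-reaches s₀ us D₀ w∈us ◅◅ insertPath-mono s₀ us D₀ refl ◅ ε)

  -- The only edge into t₀ leaves w, and the inserted path avoids both w and t₀.
  unreachable : ¬ Reach (applyInputSeq α D₀)
  unreachable reach = proj₂ (safe-path ((λ ()) , (λ ()))) refl
    where
    F : InputDB n
    F = applyInputSeq α D₀
    Safe : Fin n → Set
    Safe v = v ≢ w × v ≢ t₀
    safe-step : ∀ {u v} → Edge F u v → Safe u → Safe v
    safe-step uv (u≢w , _) with insertPath-new s₀ (tabulate x) D₀ uv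
    ... | inj₁ uv₀ = contradiction (⌊≟⌋⇒≡ (∧-conicalˡ _ _ uv₀)) u≢w
    ... | inj₂ v∈xs with ∈-tabulate⁻ {f = x} v∈xs
    ...   | i , refl = (λ ()) , (λ ())
    safe-path : Safe s₀ → Safe t₀
    safe-path = fold (λ u v → Safe u → Safe v) (λ e k → k ∘ safe-step e) id
      (subst₂ (Star (Edge F)) (applyInputSeq-s α D₀) (applyInputSeq-t α D₀) reach)

theorem7p2 : (P : DynPropCQProgram) → ¬ Maintains P
theorem7p2 P maintains = unreachable (Equivalence.to (maintains n D₀ α)
  (Qval-reflects final-reflects λ j → Equivalence.from (maintains n D₀ α[ j ]) (reachable j)))
  where open Counterexample P
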